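{- Let $\mathcal{F}$ be a filter on a semigroup $G$, $n\ge0$, and $A,D\subseteq G$ with $D$ $n$-thick in $\Delta(A)$. (a) $D$ is $n$-thick in $\Delta(\tilde A)$ for every $\tilde A\precsim_\mathcal{F} A$. (b) If $\mathcal{F}$ respects recurrence and $A$ is $n$-recurrent, then $D$ is $n$-thick in $\Delta(A_0)$ for every $A_0\supseteq A$.
   Context: A filter $\mathcal{F}$ on $G$: nonempty family of subsets not containing $\emptyset$, closed upward and under finite intersections; $\mathcal{F}$-small means the complement is in $\mathcal{F}$; $\mathcal{F}$-positive means not $\mathcal{F}$-small; "$\exists^\mathcal{F} g\in D\,P(g)$" means $\{g\in D : P(g)\}$ is $\mathcal{F}$-positive. $A\sim_\mathcal{F} B$ if $A\triangle B$ is $\mathcal{F}$-small; $\tilde A\precsim_\mathcal{F} A$ if $\tilde A\sim_\mathcal{F} A$ and $\tilde A\subseteq A$. $Ag^{ -1}:=\{x : xg\in A\}$, $\partial_gA := A\cap Ag^{ -1}$. Recurrence: $A$ is $0$-recurrent if $\mathcal{F}$-positive; for $n\ge1$, $\Delta^n(A) := \{g : \partial_gA \text{ is } (n-1)\text{ -recurrent}\}$, $A$ is $n$-recurrent if $\Delta^n(A)$ is $\mathcal{F}$-positive, $\Delta(A)=\Delta^1(A)$. $\mathcal{F}$ respects recurrence if for all $n\ge1$ and $A\sim_\mathcal{F}\tilde A$, $A$ is $n$-recurrent iff $\tilde A$ is. Thickness: every $D$ is $0$-thick in $\Delta(A)$ for every $A$; for $n\ge1$, $D$ is $n$-thick in $\Delta(A)$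 if for every $n$-recurrent $\tilde A\precsim_\mathcal{F} A$, $\exists^\mathcal{F} g\in D$ such that $\partial_g\tilde A$ is $(n-1)$-recurrent and $\partial_gD$ is $(n-1)$-thick in $\Delta(\partial_g\tilde A)$. -}

module Defs where

open import Level using (Level; _⊔_; Lift)
open import Data.Nat using (ℕ; zero; suc)
open import Data.Product using (Σ; _×_; _,_)
open import Data.Sum using (_⊎_)
open import Data.Unit.Polymorphic using (⊤)
open import Data.Empty using (⊥)
open import Relation.Nullary using (¬_)
open import Relation.Unary using (Pred; _⊆_; _∩_)
open import Algebra.Bundles using (Semigroup)

record IsFilter {c ℓs ℓ ℓ'} (S : Semigroup c ℓs)
                (F : Pred (Pred (Semigroup.Carrier S) ℓ) ℓ') : Set (c ⊔ Level.suc ℓ ⊔ ℓ') where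
  field
    nonempty  : Σ (Pred (Semigroup.Carrier S) ℓ) F
    no-empty  : ¬ F (λ _ → Lift ℓ ⊥)
    upward    : ∀ {A B} → F A → A ⊆ B → F B
    intersect : ∀ {A B} → F A → F B → F (A ∩ B)

module FilterDefs {c ℓs ℓ ℓ'} (S : Semigroup c ℓs)
                  (F : Pred (Pred (Semigroup.Carrier S) ℓ) ℓ') where

  open Semigroup S using (Carrier; _∙_)

  G : Set c
  G = Carrier

  Subset : Set (c ⊔ Level.suc ℓ)
  Subset = Pred G ℓ

  -- P is F-small iff its complement belongs to F.  Since F is upward closed,
  -- this is "some member of F is contained in the complement of P"; phrased
  -- this way so that it also applies to predicates of higher universe level
  -- (needed for ∃^F over thickness conditions).
  Small : ∀ {a} → Pred G a → Set (c ⊔ Level.suc ℓ ⊔ ℓ' ⊔ a)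
  Small P = Σ Subset λ B → F B × (∀ {x} → B x → ¬ P x)

  Positive : ∀ {a} → Pred G a → Set (c ⊔ Level.suc ℓ ⊔ ℓ' ⊔ a)
  Positive P = ¬ Small P

  _△_ : Subset → Subset → Subset
  A △ B = λ x → (A x × ¬ B x) ⊎ (B x × ¬ A x)

  _∼_ : Subset → Subset → Set (c ⊔ Level.suc ℓ ⊔ ℓ')
  A ∼ B = Small (A △ B)

  _≾_ : Subset → Subset → Set (c ⊔ Level.suc ℓ ⊔ ℓ')
  Ã ≾ A = (Ã ∼ A) × (Ã ⊆ A)

  _g⁻¹[_] : Subset → G → Subset
  A g⁻¹[ g ] = λ x → A (x ∙ g)

  ∂ : G → Subset → Subset
  ∂ g A = A ∩ (A g⁻¹[ g ])

  Recurrent : ℕ → Subset → Set (c ⊔ Level.suc ℓ ⊔ ℓ')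
  Recurrent zero    A = Positive A
  Recurrent (suc n) A = Positive (λ g → Recurrent n (∂ g A))

  -- Δⁿ(A) for n ≥ 1 (Δ^(suc n))
  Δ^suc : ℕ → Subset → Pred G (c ⊔ Level.suc ℓ ⊔ ℓ')
  Δ^suc n A = λ g → Recurrent n (∂ g A)

  RespectsRecurrence : Set (c ⊔ Level.suc ℓ ⊔ ℓ')
  RespectsRecurrence = ∀ (n : ℕ) (A Ã : Subset) → A ∼ Ã →
    (Recurrent (suc n) A → Recurrent (suc n) Ã) × (Recurrent (suc n) Ã → Recurrent (suc n) A)

  Thick : ℕ → Subset → Subset → Set (c ⊔ Level.suc ℓ ⊔ ℓ')
  Thick zero    D A = ⊤
  Thick (suc n) D A = ∀ (Ã : Subset) → Ã ≾ A → Recurrent (suc n) Ã →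
    Positive (λ g → D g × Recurrent n (∂ g Ã) × Thick n (∂ g D) (∂ g Ã))

-- Part (a) is immediate from the definition once ≾ is known to be
-- transitive; this rests on ∼ being transitive, which in turn follows from
-- the fact that the union of two F-small sets is F-small (stated
-- constructively in `small-combine`).
--
-- Part (b) is by induction on n.  Given Ã ≾ A₀ we test the thickness of D
-- against Â = Ã ∩ A instead: Â ≾ A (`restrict-≾`), so Â is recurrent
-- because A is and F respects recurrence.  Thickness of D in Δ(A) yields
-- F-positively many g ∈ D with ∂_g Â recurrent and ∂_g D thick in
-- Δ(∂_g Â); since ∂_g Â ⊆ ∂_g Ã, monotonicity of recurrence and the
-- induction hypothesis transfer both properties to ∂_g Ã.
module Submission where

open import Defs
open import Data.Nat using (ℕ; zero; suc)
open import Data.Product using (_×_; _,_; proj₁; proj₂)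
open import Data.Sum using (inj₁; inj₂)
open import Data.Unit.Polymorphic using (tt)
open import Data.Empty using (⊥-elim)
open import Relation.Nullary using (¬_)
open import Relation.Unary using (Pred; _⊆_; _∩_)
open import Algebra.Bundles using (Semigroup)

module Thickness {c ℓs ℓ ℓ'} (S : Semigroup c ℓs)
                 (F : Pred (Pred (Semigroup.Carrier S) ℓ) ℓ') (isF : IsFilter S F) where
  open FilterDefs S F
  open IsFilter isF using (intersect)

  small-mono : ∀ {a b} {P : Pred G a} {Q : Pred G b} → P ⊆ Q → Small Q → Small P
  small-mono P⊆Q (B , FB , B∩Q=∅) = B , FB , λ Bx Px → B∩Q=∅ Bx (P⊆Q Px)

  positive-mono : ∀ {a b} {P : Pred G a} {Q : Pred G b} → P ⊆ Q → Positive P → Positive Q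
  positive-mono P⊆Q posP smallQ = posP (small-mono P⊆Q smallQ)

  -- If R is covered by P ∪ Q (in the constructive form: outside P and
  -- outside Q means outside R) and P, Q are F-small, then so is R.
  small-combine : ∀ {P Q R : Subset} → Small P → Small Q →
                  (∀ {x} → ¬ P x → ¬ Q x → ¬ R x) → Small R
  small-combine (B₁ , FB₁ , B₁∩P=∅) (B₂ , FB₂ , B₂∩Q=∅) cover =
    B₁ ∩ B₂ , intersect FB₁ FB₂ , λ (B₁x , B₂x) → cover (B₁∩P=∅ B₁x) (B₂∩Q=∅ B₂x)

  ∼-sym : ∀ {A B} → A ∼ B → B ∼ A
  ∼-sym = small-mono λ { (inj₁ p) → inj₂ p ; (inj₂ p) → inj₁ p }

  ∼-trans : ∀ {A B C} → A ∼ B → B ∼ C → A ∼ C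
  ∼-trans {A} {B} {C} A∼B B∼C = small-combine A∼B B∼C outside
    where
    outside : ∀ {x} → ¬ (A △ B) x → ¬ (B △ C) x → ¬ (A △ C) x
    outside ¬AB ¬BC (inj₁ (Ax , ¬Cx)) = ¬AB (inj₁ (Ax , λ Bx → ¬BC (inj₁ (Bx , ¬Cx))))
    outside ¬AB ¬BC (inj₂ (Cx , ¬Ax)) = ¬BC (inj₂ (Cx , λ Bx → ¬AB (inj₂ (Bx , ¬Ax))))

  ≾-trans : ∀ {Â Ã A} → Â ≾ Ã → Ã ≾ A → Â ≾ A
  ≾-trans (Â∼Ã , Â⊆Ã) (Ã∼A , Ã⊆A) = ∼-trans Â∼Ã Ã∼A , λ Âx → Ã⊆A (Â⊆Ã Âx)

  restrict-≾ : ∀ {Ã A A₀} → A ⊆ A₀ → Ã ∼ A₀ → (Ã ∩ A) ≾ A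
  restrict-≾ {Ã} {A} {A₀} A⊆A₀ Ã∼A₀ = small-mono inside (∼-sym Ã∼A₀) , proj₂
    where
    inside : (Ã ∩ A) △ A ⊆ A₀ △ Ã
    inside (inj₁ ((_ , Ax) , ¬Ax)) = ⊥-elim (¬Ax Ax)
    inside (inj₂ (Ax , ¬ÃAx))     = inj₁ (A⊆A₀ Ax , λ Ãx → ¬ÃAx (Ãx , Ax))

  ∂-mono : ∀ g {A B} → A ⊆ B → ∂ g A ⊆ ∂ g B
  ∂-mono g A⊆B (Ax , Axg) = A⊆B Ax , A⊆B Axg

  recurrent-mono : ∀ n {A B} → A ⊆ B → Recurrent n A → Recurrent n B
  recurrent-mono zero    {A} {B} A⊆B = positive-mono A⊆B
  recurrent-mono (suc n) {A} {B} A⊆B = positive-mono λ {g} → recurrent-mono n (∂-mono g {A} {B} A⊆B)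

  thick-≾ : ∀ n {D A Ã} → Thick n D A → Ã ≾ A → Thick n D Ã
  thick-≾ zero    _ _ = tt
  thick-≾ (suc n) thickA Ã≾A Â Â≾Ã = thickA Â (≾-trans Â≾Ã Ã≾A)

  thick-⊇ : RespectsRecurrence → ∀ n {D A A₀} →
            Thick n D A → Recurrent n A → A ⊆ A₀ → Thick n D A₀
  thick-⊇ respects zero    _ _ _ = tt
  thick-⊇ respects (suc n) {D} {A} thickA recA A⊆A₀ Ã (Ã∼A₀ , _) _ =
    positive-mono transfer (thickA Â Â≾A recÂ)
    where
    Â : Subset
    Â = Ã ∩ A

    Â≾A : Â ≾ A
    Â≾A = restrict-≾ A⊆A₀ Ã∼A₀

    recÂ : Recurrent (suc n) Â
    recÂ = proj₂ (respects n Â A (proj₁ Â≾A)) recA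

    transfer : ∀ {g} → D g × Recurrent n (∂ g Â) × Thick n (∂ g D) (∂ g Â) →
                       D g × Recurrent n (∂ g Ã) × Thick n (∂ g D) (∂ g Ã)
    transfer {g} (Dg , rec , thick) =
      Dg , recurrent-mono n ∂Â⊆∂Ã rec , thick-⊇ respects n thick rec ∂Â⊆∂Ã
      where
      ∂Â⊆∂Ã : ∂ g Â ⊆ ∂ g Ã
      ∂Â⊆∂Ã = ∂-mono g {Â} {Ã} proj₁

mainTheorem11 : ∀ {c ℓs ℓ ℓ'} (S : Semigroup c ℓs)
                  (F : Pred (Pred (Semigroup.Carrier S) ℓ) ℓ') → IsFilter S F →
                  (n : ℕ) (A D : Pred (Semigroup.Carrier S) ℓ) →
                  FilterDefs.Thick S F n D A →
                  ((Ã : Pred (Semigroup.Carrier S) ℓ) → FilterDefs._≾_ S F Ã A →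
                     FilterDefs.Thick S F n D Ã)
                  ×
                  (FilterDefs.RespectsRecurrence S F → FilterDefs.Recurrent S F n A →
                     (A₀ : Pred (Semigroup.Carrier S) ℓ) → A ⊆ A₀ →
                     FilterDefs.Thick S F n D A₀)
mainTheorem11 S F isF n A D thickA =
  (λ Ã Ã≾A → thick-≾ n thickA Ã≾A) ,
  (λ respects recA A₀ A⊆A₀ → thick-⊇ respects n thickA recA A⊆A₀)
  where open Thickness S F isF
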